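{- For every finite multiset $\Gamma$ of formulas and every formula $C$: $\Gamma\Rightarrow C$ is derivable in $\mathsf{GF}$ if and only if $\vdash_{\mathsf{F}}\bigwedge\Gamma\rightarrow C$.
   Context: Formulas are built from a countable set of propositional atoms and $\bot$ using $\wedge,\vee,\rightarrow$; $A\leftrightarrow B$ abbreviates $(A\rightarrow B)\wedge(B\rightarrow A)$. $\bigwedge\Gamma$ is the conjunction of the formulas of $\Gamma$ (empty conjunction read as $\bot\rightarrow\bot$). Sequent calculus $\mathsf{GF}$ (sequents $\Gamma\Rightarrow C$, $\Gamma$ finite multiset, $C$ a formula, $p$ atomic): (Ax) $p,\Gamma\Rightarrow p$; ($\bot_L$) $\bot,\Gamma\Rightarrow C$; ($\wedge_L$) from $A,B,\Gamma\Rightarrow C$ infer $A\wedge B,\Gamma\Rightarrow C$; ($\wedge_R$) from $\Gamma\Rightarrow A$ and $\Gamma\Rightarrow B$ infer $\Gamma\Rightarrow A\wedge B$; ($\vee_L$) from $A,\Gamma\Rightarrow C$ and $B,\Gamma\Rightarrow C$ infer $A\vee B,\Gamma\Rightarrow C$; ($\vee_R^1$) from $\Gamma\Rightarrow A$ infer $\Gamma\Rightarrow A\vee B$; ($\vee_R^2$) from $\Gamma\Rightarrow B$ infer $\Gamma\Rightarrow A\vee B$; ($\rightarrow_R$) from $A\Rightarrow B$ infer $\Gamma\Rightarrow A\rightarrow B$; ($\rightarrow_{LR}$) from $A\Rightarrow B$, $B\Rightarrow A$, $C\Rightarrow D$, $D\Rightarrow C$ infer $\Gamma,A\rightarrow C\Rightarrow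 B\rightarrow D$; ($\rightarrow_I$) from $\Gamma\Rightarrow B\rightarrow C$ and $\Gamma\Rightarrow C\rightarrow D$ infer $\Gamma\Rightarrow B\rightarrow D$; ($\rightarrow_C$) from $\Gamma\Rightarrow B\rightarrow C$ and $\Gamma\Rightarrow B\rightarrow D$ infer $\Gamma\Rightarrow B\rightarrow C\wedge D$; ($\rightarrow_D$) from $\Gamma\Rightarrow B\rightarrow C$ and $\Gamma\Rightarrow D\rightarrow C$ infer $\Gamma\Rightarrow B\vee D\rightarrow C$. Hilbert system $\mathsf{WF}$: axioms all instances of $A\rightarrow(A\vee B)$; $B\rightarrow(A\vee B)$; $(A\wedge B)\rightarrow A$; $(A\wedge B)\rightarrow B$; $A\wedge(B\vee C)\rightarrow(A\wedge B)\vee(A\wedge C)$; $A\rightarrow A$; $\bot\rightarrow A$; rules: from $A$, $A\rightarrow B$ infer $B$; from $A$ infer $B\rightarrow A$; from $A\rightarrow B$, $B\rightarrow C$ infer $A\rightarrow C$; from $A\rightarrow B$, $A\rightarrow C$ infer $A\rightarrow(B\wedge C)$; from $A\rightarrow C$, $B\rightarrow C$ infer $(A\vee B)\rightarrow C$; from $A$, $B$ infer $A\wedge B$; from $A\leftrightarrow B$, $C\leftrightarrow D$ infer $(A\rightarrow C)\leftrightarrow(B\rightarrow D)$. $\mathsf{F}$ is $\mathsf{WF}$ plus all instances of the axioms $(A\rightarrow B)\wedge(B\rightarrow C)\rightarrow(A\rightarrow C)$, $(A\rightarrow B)\wedge(A\rightarrow C)\rightarrow(A\rightarrow B\wedge C)$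 and $(A\rightarrow C)\wedge(B\rightarrow C)\rightarrow(A\vee B\rightarrow C)$. -}

module Defs where

open import Data.Nat using (ℕ)
open import Data.List using (List; []; _∷_; _++_)

data Fm : Set where
  atom : ℕ → Fm
  ⊥'   : Fm
  _∧'_ : Fm → Fm → Fm
  _∨'_ : Fm → Fm → Fm
  _⇒_  : Fm → Fm → Fm

infixr 6 _∧'_
infixr 5 _∨'_
infixr 4 _⇒_

_⇔'_ : Fm → Fm → Fm
A ⇔' B = (A ⇒ B) ∧' (B ⇒ A)

⋀ : List Fm → Fm
⋀ []            = ⊥' ⇒ ⊥'
⋀ (A ∷ [])      = A
⋀ (A ∷ B ∷ Γ)   = A ∧' ⋀ (B ∷ Γ)

-- Multisets are represented as lists; the principal
-- formula of a left rule / axiom may sit at any position (Γ₁ ++ X ∷ Γ₂),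
-- so derivability does not depend on the order of the context.
data GF : List Fm → Fm → Set where
  ax    : ∀ Γ₁ Γ₂ p → GF (Γ₁ ++ atom p ∷ Γ₂) (atom p)
  ⊥L    : ∀ Γ₁ Γ₂ C → GF (Γ₁ ++ ⊥' ∷ Γ₂) C
  ∧L    : ∀ Γ₁ Γ₂ {A B C} → GF (Γ₁ ++ A ∷ B ∷ Γ₂) C → GF (Γ₁ ++ (A ∧' B) ∷ Γ₂) C
  ∧R    : ∀ {Γ A B} → GF Γ A → GF Γ B → GF Γ (A ∧' B)
  ∨L    : ∀ Γ₁ Γ₂ {A B C} → GF (Γ₁ ++ A ∷ Γ₂) C → GF (Γ₁ ++ B ∷ Γ₂) C
          → GF (Γ₁ ++ (A ∨' B) ∷ Γ₂) C
  ∨R1   : ∀ {Γ A B} → GF Γ A → GF Γ (A ∨' B)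
  ∨R2   : ∀ {Γ A B} → GF Γ B → GF Γ (A ∨' B)
  ⇒R    : ∀ {Γ A B} → GF (A ∷ []) B → GF Γ (A ⇒ B)
  ⇒LR   : ∀ Γ₁ Γ₂ {A B C D} → GF (A ∷ []) B → GF (B ∷ []) A
          → GF (C ∷ []) D → GF (D ∷ []) C
          → GF (Γ₁ ++ (A ⇒ C) ∷ Γ₂) (B ⇒ D)
  ⇒I    : ∀ {Γ B C D} → GF Γ (B ⇒ C) → GF Γ (C ⇒ D) → GF Γ (B ⇒ D)
  ⇒C    : ∀ {Γ B C D} → GF Γ (B ⇒ C) → GF Γ (B ⇒ D) → GF Γ (B ⇒ C ∧' D)
  ⇒D    : ∀ {Γ B C D} → GF Γ (B ⇒ C) → GF Γ (D ⇒ C) → GF Γ (B ∨' D ⇒ C)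

-- Hilbert system F (= WF plus three extra axiom schemes).
data ⊢F : Fm → Set where
  a∨1   : ∀ A B → ⊢F (A ⇒ A ∨' B)
  a∨2   : ∀ A B → ⊢F (B ⇒ A ∨' B)
  a∧1   : ∀ A B → ⊢F (A ∧' B ⇒ A)
  a∧2   : ∀ A B → ⊢F (A ∧' B ⇒ B)
  adist : ∀ A B C → ⊢F (A ∧' (B ∨' C) ⇒ (A ∧' B) ∨' (A ∧' C))
  aid   : ∀ A → ⊢F (A ⇒ A)
  a⊥    : ∀ A → ⊢F (⊥' ⇒ A)
  mp    : ∀ {A B} → ⊢F A → ⊢F (A ⇒ B) → ⊢F B
  weak  : ∀ {A} B → ⊢F A → ⊢F (B ⇒ A)
  trans : ∀ {A B C} → ⊢F (A ⇒ B) → ⊢F (B ⇒ C) → ⊢F (A ⇒ C)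
  rconj : ∀ {A B C} → ⊢F (A ⇒ B) → ⊢F (A ⇒ C) → ⊢F (A ⇒ B ∧' C)
  rdisj : ∀ {A B C} → ⊢F (A ⇒ C) → ⊢F (B ⇒ C) → ⊢F (A ∨' B ⇒ C)
  adj   : ∀ {A B} → ⊢F A → ⊢F B → ⊢F (A ∧' B)
  rimp  : ∀ {A B C D} → ⊢F (A ⇔' B) → ⊢F (C ⇔' D) → ⊢F ((A ⇒ C) ⇔' (B ⇒ D))
  -- extra axioms of F
  fI    : ∀ A B C → ⊢F ((A ⇒ B) ∧' (B ⇒ C) ⇒ (A ⇒ C))
  fC    : ∀ A B C → ⊢F ((A ⇒ B) ∧' (A ⇒ C) ⇒ (A ⇒ B ∧' C))
  fD    : ∀ A B C → ⊢F ((A ⇒ C) ∧' (B ⇒ C) ⇒ (A ∨' B ⇒ C))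

-- Soundness reads every rule of GF as a derived rule of F; the three axioms that
-- F adds to WF are what validate ⇒I, ⇒C and ⇒D under hypotheses. Completeness
-- derives every theorem of F in the empty context, inverting ⇒R there for modus
-- ponens and for the congruence rule. Modus ponens needs cut, which is
-- admissible by induction on the cut formula and then on the derivation, using
-- invertibility of ∧L, ∨L and ∧R; a principal cut on an implication needs no
-- induction at all, because ⇒LR only relates provably equivalent formulas and
-- ⇒I composes the resulting implications. Finally, a derivation of the sequent
-- ⋀ Γ ⇒ C becomes one of Γ ⇒ C by a cut against Γ ⇒ ⋀ Γ.

module Submission where

open import Data.List using (List; []; _∷_; _++_)
open import Data.List.Properties using (++-assoc; ++-conicalʳ)
open import Data.List.Membership.Propositional.Properties using (∈-insert; ∈-∃++)
open import Data.List.Relation.Binary.Permutation.Propositional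
  using (_↭_; ↭-refl; ↭-sym; ↭-trans; ↭-swap)
open import Data.List.Relation.Binary.Permutation.Propositional.Properties
  using (shift; shifts; drop-mid; ++⁺ˡ; ∈-resp-↭; ++-comm)
open import Data.List.Relation.Unary.All as All using (All; []; _∷_)
open import Data.List.Relation.Unary.All.Properties using (++⁺; ++⁻)
open import Data.Product using (_×_; _,_; ∃₂)
open import Function using (case_of_)
open import Relation.Binary.PropositionalEquality using (_≡_; refl; sym; subst)

open import Defs

Ctx : Set
Ctx = List Fm

↭-split : ∀ Σ₁ Σ₂ {X Σ} → Σ₁ ++ X ∷ Σ₂ ↭ Σ →
          ∃₂ λ (Δ₁ Δ₂ : Ctx) → Σ ≡ Δ₁ ++ X ∷ Δ₂ × Σ₁ ++ Σ₂ ↭ Δ₁ ++ Δ₂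
↭-split Σ₁ Σ₂ h with ∈-∃++ (∈-resp-↭ h (∈-insert Σ₁))
... | Δ₁ , Δ₂ , refl = Δ₁ , Δ₂ , refl , drop-mid Σ₁ Δ₁ h

↭-insert : ∀ Σ₁ Σ₂ Δ₁ Δ₂ (Ω : Ctx) → Σ₁ ++ Σ₂ ↭ Δ₁ ++ Δ₂ → Σ₁ ++ Ω ++ Σ₂ ↭ Δ₁ ++ Ω ++ Δ₂
↭-insert Σ₁ Σ₂ Δ₁ Δ₂ Ω k = ↭-trans (shifts Σ₁ Ω) (↭-trans (++⁺ˡ Ω k) (↭-sym (shifts Δ₁ Ω)))

-- Is the principal formula X of a rule, applied at position Σ₁ of a context
-- Σ ↭ Y ∷ Γ, the distinguished formula Y or a formula of Γ?
data Occurrence (Σ₁ Σ₂ : Ctx) (X : Fm) : Fm → Ctx → Set where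
  principal : ∀ {Γ} → Σ₁ ++ Σ₂ ↭ Γ → Occurrence Σ₁ Σ₂ X X Γ
  side      : ∀ {Y} Γ₁ Γ₂ → Σ₁ ++ Σ₂ ↭ Y ∷ Γ₁ ++ Γ₂ → Occurrence Σ₁ Σ₂ X Y (Γ₁ ++ X ∷ Γ₂)

occurrence : ∀ Σ₁ Σ₂ {X Y Γ} → Σ₁ ++ X ∷ Σ₂ ↭ Y ∷ Γ → Occurrence Σ₁ Σ₂ X Y Γ
occurrence Σ₁ Σ₂ h with ↭-split Σ₁ Σ₂ h
... | []     , _  , refl , k = principal k
... | _ ∷ Γ₁ , Γ₂ , refl , k = side Γ₁ Γ₂ k

exchange : ∀ {Σ Σ′ C} → GF Σ C → Σ ↭ Σ′ → GF Σ′ C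
exchange (ax Σ₁ Σ₂ p) h with ↭-split Σ₁ Σ₂ h
... | Δ₁ , Δ₂ , refl , _ = ax Δ₁ Δ₂ p
exchange (⊥L Σ₁ Σ₂ C) h with ↭-split Σ₁ Σ₂ h
... | Δ₁ , Δ₂ , refl , _ = ⊥L Δ₁ Δ₂ C
exchange (∧L Σ₁ Σ₂ {A} {B} d) h with ↭-split Σ₁ Σ₂ h
... | Δ₁ , Δ₂ , refl , k = ∧L Δ₁ Δ₂ (exchange d (↭-insert Σ₁ Σ₂ Δ₁ Δ₂ (A ∷ B ∷ []) k))
exchange (∨L Σ₁ Σ₂ {A} {B} d e) h with ↭-split Σ₁ Σ₂ h
... | Δ₁ , Δ₂ , refl , k = ∨L Δ₁ Δ₂ (exchange d (↭-insert Σ₁ Σ₂ Δ₁ Δ₂ (A ∷ []) k))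
                                     (exchange e (↭-insert Σ₁ Σ₂ Δ₁ Δ₂ (B ∷ []) k))
exchange (⇒LR Σ₁ Σ₂ a b c d) h with ↭-split Σ₁ Σ₂ h
... | Δ₁ , Δ₂ , refl , _ = ⇒LR Δ₁ Δ₂ a b c d
exchange (∧R d e) h = ∧R (exchange d h) (exchange e h)
exchange (∨R1 d)  h = ∨R1 (exchange d h)
exchange (∨R2 d)  h = ∨R2 (exchange d h)
exchange (⇒R d)   h = ⇒R d
exchange (⇒I d e) h = ⇒I (exchange d h) (exchange e h)
exchange (⇒C d e) h = ⇒C (exchange d h) (exchange e h)
exchange (⇒D d e) h = ⇒D (exchange d h) (exchange e h)

weaken : ∀ X {Γ C} → GF Γ C → GF (X ∷ Γ) C
weaken X (ax Γ₁ Γ₂ p)        = ax (X ∷ Γ₁) Γ₂ p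
weaken X (⊥L Γ₁ Γ₂ C)        = ⊥L (X ∷ Γ₁) Γ₂ C
weaken X (∧L Γ₁ Γ₂ d)        = ∧L (X ∷ Γ₁) Γ₂ (weaken X d)
weaken X (∨L Γ₁ Γ₂ d e)      = ∨L (X ∷ Γ₁) Γ₂ (weaken X d) (weaken X e)
weaken X (⇒LR Γ₁ Γ₂ a b c d) = ⇒LR (X ∷ Γ₁) Γ₂ a b c d
weaken X (∧R d e)            = ∧R (weaken X d) (weaken X e)
weaken X (∨R1 d)             = ∨R1 (weaken X d)
weaken X (∨R2 d)             = ∨R2 (weaken X d)
weaken X (⇒R d)              = ⇒R d
weaken X (⇒I d e)            = ⇒I (weaken X d) (weaken X e)
weaken X (⇒C d e)            = ⇒C (weaken X d) (weaken X e)
weaken X (⇒D d e)            = ⇒D (weaken X d) (weaken X e)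

weaken-++ : ∀ Ω {Γ C} → GF Γ C → GF (Ω ++ Γ) C
weaken-++ []      d = d
weaken-++ (X ∷ Ω) d = weaken X (weaken-++ Ω d)

identity : ∀ A {Γ} → GF (A ∷ Γ) A
identity (atom p) {Γ} = ax [] Γ p
identity ⊥'       {Γ} = ⊥L [] Γ ⊥'
identity (A ∧' B) {Γ} = ∧L [] _ (∧R (identity A) (weaken A (identity B)))
identity (A ∨' B) {Γ} = ∨L [] _ (∨R1 (identity A)) (∨R2 (identity B))
identity (A ⇒ B)  {Γ} = ⇒LR [] _ (identity A) (identity A) (identity B) (identity B)

data LeftPremise : Fm → Ctx → Set where
  ∧-premise  : ∀ {A B} → LeftPremise (A ∧' B) (A ∷ B ∷ [])
  ∨-premise₁ : ∀ {A B} → LeftPremise (A ∨' B) (A ∷ [])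
  ∨-premise₂ : ∀ {A B} → LeftPremise (A ∨' B) (B ∷ [])

reassoc : ∀ Ω Γ₁ {Γ₂ C} → GF ((Ω ++ Γ₁) ++ Γ₂) C → GF (Ω ++ Γ₁ ++ Γ₂) C
reassoc Ω Γ₁ {Γ₂} {C} = subst (λ Δ → GF Δ C) (++-assoc Ω Γ₁ Γ₂)

reassoc⁻ : ∀ Ω Γ₁ {Γ₂ C} → GF (Ω ++ Γ₁ ++ Γ₂) C → GF ((Ω ++ Γ₁) ++ Γ₂) C
reassoc⁻ Ω Γ₁ {Γ₂} {C} = subst (λ Δ → GF Δ C) (sym (++-assoc Ω Γ₁ Γ₂))

left-inversion : ∀ {X Ω Σ Γ C} → LeftPremise X Ω → GF Σ C → Σ ↭ X ∷ Γ → GF (Ω ++ Γ) C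
left-inversion p (ax Σ₁ Σ₂ q) h with occurrence Σ₁ Σ₂ h
left-inversion () (ax Σ₁ Σ₂ q) h | principal _
left-inversion {Ω = Ω} p (ax Σ₁ Σ₂ q) h | side Γ₁ Γ₂ _ = reassoc Ω Γ₁ (ax (Ω ++ Γ₁) Γ₂ q)
left-inversion p (⊥L Σ₁ Σ₂ C) h with occurrence Σ₁ Σ₂ h
left-inversion () (⊥L Σ₁ Σ₂ C) h | principal _
left-inversion {Ω = Ω} p (⊥L Σ₁ Σ₂ C) h | side Γ₁ Γ₂ _ = reassoc Ω Γ₁ (⊥L (Ω ++ Γ₁) Γ₂ C)
left-inversion p (∧L Σ₁ Σ₂ {A} {B} d) h with occurrence Σ₁ Σ₂ h
left-inversion ∧-premise (∧L Σ₁ Σ₂ {A} {B} d) h | principal k =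
  exchange d (↭-insert Σ₁ Σ₂ [] _ (A ∷ B ∷ []) k)
left-inversion {X} {Ω} p (∧L Σ₁ Σ₂ {A} {B} d) h | side Γ₁ Γ₂ k =
  reassoc Ω Γ₁ (∧L (Ω ++ Γ₁) Γ₂ (reassoc⁻ Ω Γ₁
    (left-inversion p d (↭-insert Σ₁ Σ₂ (X ∷ Γ₁) Γ₂ (A ∷ B ∷ []) k))))
left-inversion p (∨L Σ₁ Σ₂ {A} {B} d e) h with occurrence Σ₁ Σ₂ h
left-inversion ∨-premise₁ (∨L Σ₁ Σ₂ {A} {B} d e) h | principal k =
  exchange d (↭-insert Σ₁ Σ₂ [] _ (A ∷ []) k)
left-inversion ∨-premise₂ (∨L Σ₁ Σ₂ {A} {B} d e) h | principal k =
  exchange e (↭-insert Σ₁ Σ₂ [] _ (B ∷ []) k)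
left-inversion {X} {Ω} p (∨L Σ₁ Σ₂ {A} {B} d e) h | side Γ₁ Γ₂ k =
  reassoc Ω Γ₁ (∨L (Ω ++ Γ₁) Γ₂
    (reassoc⁻ Ω Γ₁ (left-inversion p d (↭-insert Σ₁ Σ₂ (X ∷ Γ₁) Γ₂ (A ∷ []) k)))
    (reassoc⁻ Ω Γ₁ (left-inversion p e (↭-insert Σ₁ Σ₂ (X ∷ Γ₁) Γ₂ (B ∷ []) k))))
left-inversion p (⇒LR Σ₁ Σ₂ a b c d) h with occurrence Σ₁ Σ₂ h
left-inversion () (⇒LR Σ₁ Σ₂ a b c d) h | principal _
left-inversion {Ω = Ω} p (⇒LR Σ₁ Σ₂ a b c d) h | side Γ₁ Γ₂ _ =
  reassoc Ω Γ₁ (⇒LR (Ω ++ Γ₁) Γ₂ a b c d)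
left-inversion p (∧R d e) h = ∧R (left-inversion p d h) (left-inversion p e h)
left-inversion p (∨R1 d)  h = ∨R1 (left-inversion p d h)
left-inversion p (∨R2 d)  h = ∨R2 (left-inversion p d h)
left-inversion p (⇒R d)   h = ⇒R d
left-inversion p (⇒I d e) h = ⇒I (left-inversion p d h) (left-inversion p e h)
left-inversion p (⇒C d e) h = ⇒C (left-inversion p d h) (left-inversion p e h)
left-inversion p (⇒D d e) h = ⇒D (left-inversion p d h) (left-inversion p e h)

left-inversion-at : ∀ Γ₁ {Γ₂ X Ω C} → LeftPremise X Ω → GF (Γ₁ ++ X ∷ Γ₂) C → GF (Γ₁ ++ Ω ++ Γ₂) C
left-inversion-at Γ₁ {Ω = Ω} p d =
  exchange (left-inversion p d (shift _ Γ₁ _)) (↭-sym (shifts Γ₁ Ω))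

⊥R-inversion : ∀ {Γ C} → GF Γ ⊥' → GF Γ C
⊥R-inversion {C = C} (⊥L Γ₁ Γ₂ _) = ⊥L Γ₁ Γ₂ C
⊥R-inversion (∧L Γ₁ Γ₂ d)   = ∧L Γ₁ Γ₂ (⊥R-inversion d)
⊥R-inversion (∨L Γ₁ Γ₂ d e) = ∨L Γ₁ Γ₂ (⊥R-inversion d) (⊥R-inversion e)

∧R-inversion : ∀ {Γ A B} → GF Γ (A ∧' B) → GF Γ A × GF Γ B
∧R-inversion (⊥L Γ₁ Γ₂ _) = ⊥L Γ₁ Γ₂ _ , ⊥L Γ₁ Γ₂ _
∧R-inversion (∧L Γ₁ Γ₂ d) with ∧R-inversion d
... | a , b = ∧L Γ₁ Γ₂ a , ∧L Γ₁ Γ₂ b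
∧R-inversion (∨L Γ₁ Γ₂ d e) with ∧R-inversion d | ∧R-inversion e
... | a , b | a′ , b′ = ∨L Γ₁ Γ₂ a a′ , ∨L Γ₁ Γ₂ b b′
∧R-inversion (∧R a b) = a , b

mutual
  cut : ∀ A {Γ Σ C} → GF Γ A → Σ ↭ A ∷ Γ → GF Σ C → GF Γ C
  cut A d h (ax Σ₁ Σ₂ p) with occurrence Σ₁ Σ₂ h
  ... | principal _     = d
  ... | side Γ₁ Γ₂ _    = ax Γ₁ Γ₂ p
  cut A d h (⊥L Σ₁ Σ₂ C) with occurrence Σ₁ Σ₂ h
  ... | principal _     = ⊥R-inversion d
  ... | side Γ₁ Γ₂ _    = ⊥L Γ₁ Γ₂ C
  cut A d h (∧L Σ₁ Σ₂ {P} {Q} e) with occurrence Σ₁ Σ₂ h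
  ... | principal k     =
    let dP , dQ = ∧R-inversion d
    in cut Q dQ ↭-refl (cut P (weaken Q dP) (↭-insert Σ₁ Σ₂ [] _ (P ∷ Q ∷ []) k) e)
  ... | side Γ₁ Γ₂ k    =
    ∧L Γ₁ Γ₂ (cut A (left-inversion-at Γ₁ ∧-premise d)
                    (↭-insert Σ₁ Σ₂ (A ∷ Γ₁) Γ₂ (P ∷ Q ∷ []) k) e)
  cut A d h (∨L Σ₁ Σ₂ {P} {Q} e₁ e₂) with occurrence Σ₁ Σ₂ h
  ... | principal k     =
    cut-∨ P Q d (exchange e₁ (↭-insert Σ₁ Σ₂ [] _ (P ∷ []) k))
                (exchange e₂ (↭-insert Σ₁ Σ₂ [] _ (Q ∷ []) k))
  ... | side Γ₁ Γ₂ k    =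
    ∨L Γ₁ Γ₂ (cut A (left-inversion-at Γ₁ ∨-premise₁ d)
                    (↭-insert Σ₁ Σ₂ (A ∷ Γ₁) Γ₂ (P ∷ []) k) e₁)
             (cut A (left-inversion-at Γ₁ ∨-premise₂ d)
                    (↭-insert Σ₁ Σ₂ (A ∷ Γ₁) Γ₂ (Q ∷ []) k) e₂)
  cut A d h (⇒LR Σ₁ Σ₂ a b c e) with occurrence Σ₁ Σ₂ h
  ... | principal _     = ⇒I (⇒R b) (⇒I d (⇒R c))   -- B ⇒ A, A ⇒ C, C ⇒ D
  ... | side Γ₁ Γ₂ _    = ⇒LR Γ₁ Γ₂ a b c e
  cut A d h (∧R e₁ e₂) = ∧R (cut A d h e₁) (cut A d h e₂)
  cut A d h (∨R1 e)    = ∨R1 (cut A d h e)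
  cut A d h (∨R2 e)    = ∨R2 (cut A d h e)
  cut A d h (⇒R e)     = ⇒R e
  cut A d h (⇒I e₁ e₂) = ⇒I (cut A d h e₁) (cut A d h e₂)
  cut A d h (⇒C e₁ e₂) = ⇒C (cut A d h e₁) (cut A d h e₂)
  cut A d h (⇒D e₁ e₂) = ⇒D (cut A d h e₁) (cut A d h e₂)

  -- ∨R is not invertible, so a principal disjunction is cut by recursion on
  -- the derivation of P ∨ Q instead.
  cut-∨ : ∀ P Q {Γ C} → GF Γ (P ∨' Q) → GF (P ∷ Γ) C → GF (Q ∷ Γ) C → GF Γ C
  cut-∨ P Q (∨R1 d) e₁ e₂ = cut P d ↭-refl e₁
  cut-∨ P Q (∨R2 d) e₁ e₂ = cut Q d ↭-refl e₂
  cut-∨ P Q {C = C} (⊥L Γ₁ Γ₂ _) e₁ e₂ = ⊥L Γ₁ Γ₂ C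
  cut-∨ P Q (∧L Γ₁ Γ₂ d) e₁ e₂ =
    ∧L Γ₁ Γ₂ (cut-∨ P Q d (left-inversion-at (P ∷ Γ₁) ∧-premise e₁)
                          (left-inversion-at (Q ∷ Γ₁) ∧-premise e₂))
  cut-∨ P Q (∨L Γ₁ Γ₂ d d′) e₁ e₂ =
    ∨L Γ₁ Γ₂ (cut-∨ P Q d  (left-inversion-at (P ∷ Γ₁) ∨-premise₁ e₁)
                           (left-inversion-at (Q ∷ Γ₁) ∨-premise₁ e₂))
             (cut-∨ P Q d′ (left-inversion-at (P ∷ Γ₁) ∨-premise₂ e₁)
                           (left-inversion-at (Q ∷ Γ₁) ∨-premise₂ e₂))

⇒R-inversion : ∀ {A B} → GF [] (A ⇒ B) → GF (A ∷ []) B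
⇒R-inversion d = invert d refl
  where
  invert : ∀ {Γ A B} → GF Γ (A ⇒ B) → Γ ≡ [] → GF (A ∷ []) B
  invert (⇒R d)               _  = d
  invert (⇒I {B = B} {C} d e) eq = cut C (invert d eq) (↭-swap B C ↭-refl) (weaken B (invert e eq))
  invert (⇒C d e)             eq = ∧R (invert d eq) (invert e eq)
  invert (⇒D d e)             eq = ∨L [] [] (invert d eq) (invert e eq)
  invert (⊥L Γ₁ _ _)          eq = case ++-conicalʳ Γ₁ _ eq of λ ()
  invert (∧L Γ₁ _ _)          eq = case ++-conicalʳ Γ₁ _ eq of λ ()
  invert (∨L Γ₁ _ _ _)        eq = case ++-conicalʳ Γ₁ _ eq of λ ()
  invert (⇒LR Γ₁ _ _ _ _ _)   eq = case ++-conicalʳ Γ₁ _ eq of λ ()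

⋀-intro : ∀ {Z} Γ → All (λ Y → ⊢F (Z ⇒ Y)) Γ → ⊢F (Z ⇒ ⋀ Γ)
⋀-intro {Z} []          []       = weak Z (aid ⊥')
⋀-intro     (_ ∷ [])    (z ∷ []) = z
⋀-intro     (_ ∷ _ ∷ Γ) (z ∷ zs) = rconj z (⋀-intro (_ ∷ Γ) zs)

⋀-elim : ∀ Γ → All (λ Y → ⊢F (⋀ Γ ⇒ Y)) Γ
⋀-elim []          = []
⋀-elim (A ∷ [])    = aid A ∷ []
⋀-elim (A ∷ B ∷ Γ) = a∧1 A (⋀ (B ∷ Γ)) ∷ All.map (trans (a∧2 A (⋀ (B ∷ Γ)))) (⋀-elim (B ∷ Γ))

⋀-elim-at : ∀ Γ₁ {X Γ₂} → ⊢F (⋀ (Γ₁ ++ X ∷ Γ₂) ⇒ X)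
⋀-elim-at Γ₁ = All.lookup (⋀-elim _) (∈-insert Γ₁)

⋀-replace : ∀ Γ₁ {X Γ₂} Ω {Z} → ⊢F (Z ⇒ ⋀ (Γ₁ ++ X ∷ Γ₂)) → All (λ Y → ⊢F (Z ⇒ Y)) Ω →
            ⊢F (Z ⇒ ⋀ (Γ₁ ++ Ω ++ Γ₂))
⋀-replace Γ₁ Ω z zs with ++⁻ Γ₁ (All.map (trans z) (⋀-elim _))
... | zs₁ , _ ∷ zs₂ = ⋀-intro _ (++⁺ zs₁ (++⁺ zs zs₂))

soundness : ∀ {Γ C} → GF Γ C → ⊢F (⋀ Γ ⇒ C)
soundness (ax Γ₁ Γ₂ p) = ⋀-elim-at Γ₁
soundness (⊥L Γ₁ Γ₂ C) = trans (⋀-elim-at Γ₁) (a⊥ C)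
soundness (∧L Γ₁ Γ₂ {A} {B} d) =
  trans (⋀-replace Γ₁ (A ∷ B ∷ []) (aid _) (trans ⊢A∧B (a∧1 A B) ∷ trans ⊢A∧B (a∧2 A B) ∷ []))
        (soundness d)
  where ⊢A∧B = ⋀-elim-at Γ₁
soundness (∨L Γ₁ Γ₂ {A} {B} d e) =
  trans (rconj (aid G) (⋀-elim-at Γ₁))
        (trans (adist G A B) (rdisj (trans (premise A) (soundness d))
                                    (trans (premise B) (soundness e))))
  where
  G = ⋀ (Γ₁ ++ (A ∨' B) ∷ Γ₂)
  premise : ∀ Y → ⊢F (G ∧' Y ⇒ ⋀ (Γ₁ ++ Y ∷ Γ₂))
  premise Y = ⋀-replace Γ₁ (Y ∷ []) (a∧1 G Y) (a∧2 G Y ∷ [])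
soundness (∧R d e) = rconj (soundness d) (soundness e)
soundness (∨R1 {A = A} {B} d) = trans (soundness d) (a∨1 A B)
soundness (∨R2 {A = A} {B} d) = trans (soundness d) (a∨2 A B)
soundness {Γ} (⇒R d) = weak (⋀ Γ) (soundness d)
soundness (⇒LR Γ₁ Γ₂ a b c d) =
  trans (⋀-elim-at Γ₁)
        (mp (rimp (adj (soundness a) (soundness b)) (adj (soundness c) (soundness d))) (a∧1 _ _))
soundness (⇒I {B = B} {C} {D} d e) = trans (rconj (soundness d) (soundness e)) (fI B C D)
soundness (⇒C {B = B} {C} {D} d e) = trans (rconj (soundness d) (soundness e)) (fC B C D)
soundness (⇒D {B = B} {C} {D} d e) = trans (rconj (soundness d) (soundness e)) (fD B D C)

⇔-inversion : ∀ {A B} → GF [] (A ⇔' B) → GF (A ∷ []) B × GF (B ∷ []) A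
⇔-inversion d with ∧R-inversion d
... | ab , ba = ⇒R-inversion ab , ⇒R-inversion ba

theorem-derivable : ∀ {A} → ⊢F A → GF [] A
theorem-derivable (a∨1 A B)     = ⇒R (∨R1 (identity A))
theorem-derivable (a∨2 A B)     = ⇒R (∨R2 (identity B))
theorem-derivable (a∧1 A B)     = ⇒R (∧L [] [] (identity A))
theorem-derivable (a∧2 A B)     = ⇒R (∧L [] [] (weaken A (identity B)))
theorem-derivable (adist A B C) = ⇒R (∧L [] [] (∨L (A ∷ []) []
  (∨R1 (∧R (identity A) (weaken A (identity B))))
  (∨R2 (∧R (identity A) (weaken A (identity C))))))
theorem-derivable (aid A)       = ⇒R (identity A)
theorem-derivable (a⊥ A)        = ⇒R (⊥L [] [] A)
theorem-derivable (mp {A} d e)  =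
  cut A (theorem-derivable d) ↭-refl (⇒R-inversion (theorem-derivable e))
theorem-derivable (weak B d)    = ⇒R (weaken B (theorem-derivable d))
theorem-derivable (trans d e)   = ⇒I (theorem-derivable d) (theorem-derivable e)
theorem-derivable (rconj d e)   = ⇒C (theorem-derivable d) (theorem-derivable e)
theorem-derivable (rdisj d e)   = ⇒D (theorem-derivable d) (theorem-derivable e)
theorem-derivable (adj d e)     = ∧R (theorem-derivable d) (theorem-derivable e)
theorem-derivable (rimp d e)
  with ⇔-inversion (theorem-derivable d) | ⇔-inversion (theorem-derivable e)
... | ab , ba | cd , dc = ∧R (⇒R (⇒LR [] [] ab ba cd dc)) (⇒R (⇒LR [] [] ba ab dc cd))
theorem-derivable (fI _ _ _)    = ⇒R (∧L [] [] (⇒I (identity _) (weaken _ (identity _))))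
theorem-derivable (fC _ _ _)    = ⇒R (∧L [] [] (⇒C (identity _) (weaken _ (identity _))))
theorem-derivable (fD _ _ _)    = ⇒R (∧L [] [] (⇒D (identity _) (weaken _ (identity _))))

⋀-right : ∀ Γ → GF Γ (⋀ Γ)
⋀-right []          = ⇒R (⊥L [] [] ⊥')
⋀-right (A ∷ [])    = identity A
⋀-right (A ∷ B ∷ Γ) = ∧R (identity A) (weaken A (⋀-right (B ∷ Γ)))

completeness : ∀ Γ {C} → ⊢F (⋀ Γ ⇒ C) → GF Γ C
completeness Γ d =
  cut (⋀ Γ) (⋀-right Γ) (++-comm Γ (⋀ Γ ∷ [])) (weaken-++ Γ (⇒R-inversion (theorem-derivable d)))

mainTheorem16 : (Γ : List Fm) (C : Fm) → (GF Γ C → ⊢F (⋀ Γ ⇒ C)) × (⊢F (⋀ Γ ⇒ C) → GF Γ C)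
mainTheorem16 Γ C = soundness , completeness Γ
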